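{- Let $\hat A$ be a continuous change action, let $U$ be the set of continuous functions $A\to A$, carrying a functional change action $\hat U=(U,\Delta U,\oplus_U,+_U,0_U)$, and let $\partial\mathrm{Ev}$ be a derivative of the evaluation map such that for all fixed $f\in U,\delta f\in\Delta U$ the map $(a,\delta a)\mapsto\partial\mathrm{Ev}((f,a),(\delta f,\delta a))$ is continuous. For $f\in U$ and $\delta f\in\Delta U$ define $\mathrm{adjust}(f,\delta f):\Delta A\to\Delta A$ by $\mathrm{adjust}(f,\delta f)(\delta a)=\partial\mathrm{Ev}((f,\mathrm{lfp}(f)),(\delta f,\delta a))$ and $\partial\mathrm{lfp}(f,\delta f)=\mathrm{lfp}_{\Delta A}(\mathrm{adjust}(f,\delta f))$. Then $\partial\mathrm{lfp}$ is a derivative of $\mathrm{lfp}:U\to A$: for all $f\in U$ and $\delta f\in\Delta U$, $\mathrm{lfp}(f\oplus_U\delta f)=\mathrm{lfp}(f)\oplus_A\partial\mathrm{lfp}(f,\delta f)$.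
   Context: A change action $\hat A=(A,\Delta A,\oplus,+,0)$ is a set $A$, a monoid $(\Delta A,+,0)$ and a monoid action $\oplus:A\times\Delta A\to A$ ($a\oplus 0=a$, $a\oplus(\delta_1+\delta_2)=(a\oplus\delta_1)\oplus\delta_2$). It is continuous if $A$ and $\Delta A$ are pointed directed-complete partial orders (every non-empty directed subset has a supremum, and there is a least element) and $\oplus$ and $+$ are continuous (monotone and preserving directed suprema). $\mathrm{lfp}(g)$ (resp. $\mathrm{lfp}_{\Delta A}(g)$) denotes the least fixed point of a continuous map $g$ on $A$ (resp. $\Delta A$). A change action $\hat U$ on $U\subseteq A\to A$ is functional if $\mathrm{Ev}(f,a)=f(a)$ is differentiable for the product change action on $U\times A$, i.e. there is $\partial\mathrm{Ev}:(U\times A)\times(\Delta U\times\Delta A)\to\Delta A$ with $(f\oplus_U\delta f)(a\oplus_A\delta a)=f(a)\oplus_A\partial\mathrm{Ev}((f,a),(\delta f,\delta a))$. -}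

module Defs where

open import Level using (Level; suc)
open import Data.Product using (Σ; ∃; _×_; _,_; proj₁; proj₂)
open import Relation.Binary.PropositionalEquality using (_≡_)
open import Relation.Binary.Definitions using (Monotonic₁)
open import Relation.Binary.Structures using (IsPartialOrder)
open import Algebra.Structures using (IsMonoid)

module _ {X : Set} (_≤_ : X → X → Set) where

  Directed : (X → Set) → Set
  Directed D = (∃ λ x → D x)
             × (∀ {x y} → D x → D y → ∃ λ z → D z × x ≤ z × y ≤ z)

  IsUpperBound : (X → Set) → X → Set
  IsUpperBound D s = ∀ {x} → D x → x ≤ s

  IsSup : (X → Set) → X → Set
  IsSup D s = IsUpperBound D s × (∀ u → IsUpperBound D u → s ≤ u)

  IsLeast : X → Set
  IsLeast b = ∀ x → b ≤ x

  IsLfp : (X → X) → X → Set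
  IsLfp g x = (g x ≡ x) × (∀ y → g y ≡ y → x ≤ y)

Image : {X Y : Set} → (X → Y) → (X → Set) → Y → Set
Image {X} f D y = ∃ λ (x : X) → D x × f x ≡ y

IsContinuous : {X Y : Set} → (X → X → Set) → (Y → Y → Set) → (X → Y) → Set₁
IsContinuous {X} _≤X_ _≤Y_ f =
  Monotonic₁ _≤X_ _≤Y_ f
  × (∀ (D : X → Set) (s : X) → Directed _≤X_ D → IsSup _≤X_ D s
       → IsSup _≤Y_ (Image f D) (f s))

_×≤_ : {X Y : Set} → (X → X → Set) → (Y → Y → Set) → (X × Y) → (X × Y) → Set
(R ×≤ S) (x , y) (x′ , y′) = R x x′ × S y y′

record PointedDCPO (X : Set) : Set₁ where
  field
    _≤_            : X → X → Set
    isPartialOrder : IsPartialOrder _≡_ _≤_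
    ⊥              : X
    ⊥-least        : IsLeast _≤_ ⊥
    sup            : ∀ (D : X → Set) → Directed _≤_ D → ∃ λ s → IsSup _≤_ D s

record ChangeAction {a : Level} (A : Set a) : Set (suc a) where
  infixl 6 _⊕_ _+_
  field
    Δ        : Set a
    _⊕_      : A → Δ → A
    _+_      : Δ → Δ → Δ
    0Δ       : Δ
    isMonoid : IsMonoid _≡_ _+_ 0Δ
    ⊕-identity : ∀ a → a ⊕ 0Δ ≡ a
    ⊕-act      : ∀ a δ₁ δ₂ → a ⊕ (δ₁ + δ₂) ≡ (a ⊕ δ₁) ⊕ δ₂

record ContinuousChangeAction (A : Set) : Set₁ where
  field
    changeAction : ChangeAction A
  open ChangeAction changeAction public
  field
    dcpoA  : PointedDCPO A
    dcpoΔ  : PointedDCPO Δ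
  _≤A_ = PointedDCPO._≤_ dcpoA
  _≤Δ_ = PointedDCPO._≤_ dcpoΔ
  field
    ⊕-continuous : IsContinuous (_≤A_ ×≤ _≤Δ_) _≤A_ (λ p → proj₁ p ⊕ proj₂ p)
    +-continuous : IsContinuous (_≤Δ_ ×≤ _≤Δ_) _≤Δ_ (λ p → proj₁ p + proj₂ p)

ContFun : {A : Set} → ContinuousChangeAction A → Set₁
ContFun {A} Â = Σ (A → A) λ f → IsContinuous _≤A_ _≤A_ f
  where open ContinuousChangeAction Â

module Submission where

open import Defs
open import Data.Product using (∃; _×_; _,_; proj₁; proj₂)
open import Relation.Binary.PropositionalEquality using (_≡_; refl; sym; subst; cong₂)
open import Relation.Binary.PropositionalEquality.Properties using (module ≡-Reasoning)
open import Relation.Binary.Definitions using (Reflexive; Transitive; Antisymmetric)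
open import Relation.Binary.Structures using (IsPartialOrder)
open import Data.Nat using (ℕ; zero; suc; _+_)
open import Data.Nat.Properties using (+-comm)
open import Data.Nat.GeneralisedArithmetic using (fold)

-- Iterate the pair map (a , δa) ↦ (f a , ∂Ev((f , a) , (δf , δa))) from (⊥ , ⊥).
-- Its first component is the Kleene chain of f, converging to lfp f; its second component
-- converges to a fixed point of adjust(f , δf), which therefore lies above ∂lfp; and by the
-- derivative condition a ⊕ δa along the iteration follows the iteration of f ⊕ δf, so it stays
-- below lfp(f ⊕ δf). Hence lfp f ⊕ ∂lfp ≤ lfp(f ⊕ δf); the converse holds because
-- lfp f ⊕ ∂lfp is itself a fixed point of f ⊕ δf.

Range : {X : Set} → (ℕ → X) → X → Set
Range c x = ∃ λ n → c n ≡ x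

module _ {X : Set} {_≤_ : X → X → Set}
         (≤-refl : Reflexive _≤_) (≤-trans : Transitive _≤_)
         {c : ℕ → X} (increasing : ∀ n → c n ≤ c (suc n)) where

  increasing-by : ∀ k m → c m ≤ c (k + m)
  increasing-by zero    m = ≤-refl
  increasing-by (suc k) m = ≤-trans (increasing-by k m) (increasing (k + m))

  Range-directed : Directed _≤_ (Range c)
  Range-directed = (c 0 , 0 , refl) , λ where
    (m , refl) (n , refl) →
      c (m + n) , (m + n , refl)
      , subst (λ i → c m ≤ c i) (+-comm n m) (increasing-by n m)
      , increasing-by m n

module _ {X Y : Set} {_≤X_ : X → X → Set} {_≤Y_ : Y → Y → Set} where

  IsSup-× : {c : ℕ → X × Y} {s₁ : X} {s₂ : Y} →
            IsSup _≤X_ (Range (λ n → proj₁ (c n))) s₁ →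
            IsSup _≤Y_ (Range (λ n → proj₂ (c n))) s₂ →
            IsSup (_≤X_ ×≤ _≤Y_) (Range c) (s₁ , s₂)
  IsSup-× (ub₁ , least₁) (ub₂ , least₂) =
      (λ { (n , refl) → ub₁ (n , refl) , ub₂ (n , refl) })
    , λ u ub → least₁ (proj₁ u) (λ { (n , refl) → proj₁ (ub (n , refl)) })
             , least₂ (proj₂ u) (λ { (n , refl) → proj₂ (ub (n , refl)) })

  module _ {h : X → Y} (h-continuous : IsContinuous _≤X_ _≤Y_ h)
           {c : ℕ → X} (c-directed : Directed _≤X_ (Range c))
           {s : X} (s-sup : IsSup _≤X_ (Range c) s) where

    continuous-sup-least : ∀ {u} → (∀ n → h (c n) ≤Y u) → h s ≤Y u
    continuous-sup-least bound =
      proj₂ (proj₂ h-continuous (Range c) s c-directed s-sup) _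
        (λ { (_ , (n , refl) , refl) → bound n })

    -- e is h ∘ c delayed by one step, so both have the same supremum.
    continuous-shift : Antisymmetric _≡_ _≤Y_ →
                       {e : ℕ → Y} → IsLeast _≤Y_ (e 0) → (∀ n → e (suc n) ≡ h (c n)) →
                       ∀ {t} → IsSup _≤Y_ (Range e) t → h s ≡ t
    continuous-shift antisym {e} e₀-least e-step {t} (t-ub , t-least) =
      antisym (continuous-sup-least λ n → subst (_≤Y t) (e-step n) (t-ub (suc n , refl)))
              (t-least (h s) e≤hs)
      where
      e≤hs : IsUpperBound _≤Y_ (Range e) (h s)
      e≤hs (zero  , refl) = e₀-least (h s)
      e≤hs (suc n , refl) = subst (_≤Y h s) (sym (e-step n)) (proj₁ h-continuous (proj₁ s-sup (n , refl)))

module _ {X : Set} {_≤_ : X → X → Set} (po : IsPartialOrder _≡_ _≤_) where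
  open IsPartialOrder po using (antisym) renaming (trans to ≤-trans; reflexive to ≤-reflexive)

  IsLfp-unique : ∀ {h x y} → IsLfp _≤_ h x → IsLfp _≤_ h y → x ≡ y
  IsLfp-unique (hx≡x , x-least) (hy≡y , y-least) = antisym (x-least _ hy≡y) (y-least _ hx≡x)

  kleene-IsLfp : {h : X → X} → IsContinuous _≤_ _≤_ h →
                 {c : ℕ → X} → IsLeast _≤_ (c 0) → (∀ n → c (suc n) ≡ h (c n)) →
                 Directed _≤_ (Range c) → ∀ {s} → IsSup _≤_ (Range c) s → IsLfp _≤_ h s
  kleene-IsLfp {h} h-continuous {c} c₀-least c-step c-directed s-sup =
      continuous-shift h-continuous c-directed s-sup antisym c₀-least c-step s-sup
    , λ y hy≡y → proj₂ s-sup y (below y hy≡y)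
    where
    below : ∀ y → h y ≡ y → IsUpperBound _≤_ (Range c) y
    below y hy≡y (zero  , refl) = c₀-least y
    below y hy≡y (suc n , refl) =
      subst (_≤ y) (sym (c-step n))
        (≤-trans (proj₁ h-continuous (below y hy≡y (n , refl))) (≤-reflexive hy≡y))

module LfpDerivative
  {A : Set} (Â : ContinuousChangeAction A)
  (Û : ChangeAction (ContFun Â))
  (∂Ev : (ContFun Â × A) → (ChangeAction.Δ Û × ContinuousChangeAction.Δ Â)
           → ContinuousChangeAction.Δ Â)
  (∂Ev-derivative : ∀ f a δf δa →
      proj₁ (ChangeAction._⊕_ Û f δf) (ContinuousChangeAction._⊕_ Â a δa)
        ≡ ContinuousChangeAction._⊕_ Â (proj₁ f a) (∂Ev (f , a) (δf , δa)))
  (∂Ev-continuous : ∀ f δf →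
      IsContinuous
        (ContinuousChangeAction._≤A_ Â ×≤ ContinuousChangeAction._≤Δ_ Â)
        (ContinuousChangeAction._≤Δ_ Â)
        (λ p → ∂Ev (f , proj₁ p) (δf , proj₂ p)))
  (f : ContFun Â) (δf : ChangeAction.Δ Û)
  where

  open ContinuousChangeAction Â
  open PointedDCPO dcpoA using () renaming (⊥ to ⊥A; ⊥-least to ⊥A-least; sup to supA)
  open PointedDCPO dcpoΔ using () renaming (⊥ to ⊥Δ; ⊥-least to ⊥Δ-least; sup to supΔ)
  module ≤A = IsPartialOrder (PointedDCPO.isPartialOrder dcpoA)
  module ≤Δ = IsPartialOrder (PointedDCPO.isPartialOrder dcpoΔ)

  _≤_ : A × Δ → A × Δ → Set
  _≤_ = _≤A_ ×≤ _≤Δ_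

  g : ContFun Â
  g = ChangeAction._⊕_ Û f δf

  adjust : A × Δ → Δ
  adjust (a , δa) = ∂Ev (f , a) (δf , δa)

  step : A × Δ → A × Δ
  step p = proj₁ f (proj₁ p) , adjust p

  iterates : ℕ → A × Δ
  iterates = fold (⊥A , ⊥Δ) step

  aₙ : ℕ → A
  aₙ n = proj₁ (iterates n)

  δaₙ : ℕ → Δ
  δaₙ n = proj₂ (iterates n)

  iterates-increasing : ∀ n → iterates n ≤ iterates (suc n)
  iterates-increasing zero    = ⊥A-least _ , ⊥Δ-least _
  iterates-increasing (suc n) =
    proj₁ (proj₂ f) (proj₁ (iterates-increasing n)) ,
    proj₁ (∂Ev-continuous f δf) (iterates-increasing n)

  iterates-directed : Directed _≤_ (Range iterates)
  iterates-directed =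
    Range-directed (≤A.refl , ≤Δ.refl)
      (λ (a≤ , δa≤) (a≤′ , δa≤′) → ≤A.trans a≤ a≤′ , ≤Δ.trans δa≤ δa≤′)
      iterates-increasing

  aₙ-directed : Directed _≤A_ (Range aₙ)
  aₙ-directed = Range-directed ≤A.refl ≤A.trans (λ n → proj₁ (iterates-increasing n))

  δaₙ-directed : Directed _≤Δ_ (Range δaₙ)
  δaₙ-directed = Range-directed ≤Δ.refl ≤Δ.trans (λ n → proj₂ (iterates-increasing n))

  a* : A
  a* = proj₁ (supA (Range aₙ) aₙ-directed)

  δa* : Δ
  δa* = proj₁ (supΔ (Range δaₙ) δaₙ-directed)

  iterates-sup : IsSup _≤_ (Range iterates) (a* , δa*)
  iterates-sup = IsSup-× (proj₂ (supA (Range aₙ) aₙ-directed)) (proj₂ (supΔ (Range δaₙ) δaₙ-directed))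

  a*-IsLfp : IsLfp _≤A_ (proj₁ f) a*
  a*-IsLfp = kleene-IsLfp (PointedDCPO.isPartialOrder dcpoA) (proj₂ f) ⊥A-least (λ _ → refl)
               aₙ-directed (proj₂ (supA (Range aₙ) aₙ-directed))

  δa*-fixed : adjust (a* , δa*) ≡ δa*
  δa*-fixed = continuous-shift (∂Ev-continuous f δf) iterates-directed iterates-sup
                ≤Δ.antisym ⊥Δ-least (λ _ → refl) (proj₂ (supΔ (Range δaₙ) δaₙ-directed))

  iterates-⊕-below : ∀ {y} → proj₁ g y ≡ y → ∀ n → (aₙ n ⊕ δaₙ n) ≤A y
  iterates-⊕-below {y} gy≡y zero =
    ≤A.trans (proj₁ ⊕-continuous (⊥A-least y , ⊥Δ-least 0Δ)) (≤A.reflexive (⊕-identity y))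
  iterates-⊕-below {y} gy≡y (suc n) =
    ≤A.trans (≤A.reflexive (sym (∂Ev-derivative f (aₙ n) δf (δaₙ n))))
      (≤A.trans (proj₁ (proj₂ g) (iterates-⊕-below gy≡y n)) (≤A.reflexive gy≡y))

  ⊕-below-IsLfp : ∀ {lfp-f ∂lfp lfp-g} →
                  IsLfp _≤A_ (proj₁ f) lfp-f →
                  IsLfp _≤Δ_ (λ δa → adjust (lfp-f , δa)) ∂lfp →
                  IsLfp _≤A_ (proj₁ g) lfp-g →
                  (lfp-f ⊕ ∂lfp) ≤A lfp-g
  ⊕-below-IsLfp {lfp-f} {∂lfp} {lfp-g} lfp-f-isLfp (_ , ∂lfp-least) (lfp-g-fixed , _) =
    ≤A.trans (proj₁ ⊕-continuous (≤A.reflexive (sym a*≡lfp-f) , ∂lfp≤δa*))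
      (continuous-sup-least ⊕-continuous iterates-directed iterates-sup
        (iterates-⊕-below lfp-g-fixed))
    where
    a*≡lfp-f : a* ≡ lfp-f
    a*≡lfp-f = IsLfp-unique (PointedDCPO.isPartialOrder dcpoA) a*-IsLfp lfp-f-isLfp
    ∂lfp≤δa* : ∂lfp ≤Δ δa*
    ∂lfp≤δa* = ∂lfp-least δa* (subst (λ a → adjust (a , δa*) ≡ δa*) a*≡lfp-f δa*-fixed)

  ⊕-fixed : ∀ {lfp-f ∂lfp} → proj₁ f lfp-f ≡ lfp-f → adjust (lfp-f , ∂lfp) ≡ ∂lfp →
            proj₁ g (lfp-f ⊕ ∂lfp) ≡ lfp-f ⊕ ∂lfp
  ⊕-fixed {lfp-f} {∂lfp} f-fixed adjust-fixed = begin
    proj₁ g (lfp-f ⊕ ∂lfp)              ≡⟨ ∂Ev-derivative f lfp-f δf ∂lfp ⟩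
    proj₁ f lfp-f ⊕ adjust (lfp-f , ∂lfp) ≡⟨ cong₂ _⊕_ f-fixed adjust-fixed ⟩
    lfp-f ⊕ ∂lfp                        ∎
    where open ≡-Reasoning

mainTheorem20 :
    {A : Set} (Â : ContinuousChangeAction A)
    (Û : ChangeAction (ContFun Â))
    (∂Ev : (ContFun Â × A) → (ChangeAction.Δ Û × ContinuousChangeAction.Δ Â)
             → ContinuousChangeAction.Δ Â)
    (∂Ev-derivative : ∀ f a δf δa →
        proj₁ (ChangeAction._⊕_ Û f δf) (ContinuousChangeAction._⊕_ Â a δa)
          ≡ ContinuousChangeAction._⊕_ Â (proj₁ f a) (∂Ev (f , a) (δf , δa)))
    (∂Ev-continuous : ∀ f δf →
        IsContinuous
          (ContinuousChangeAction._≤A_ Â ×≤ ContinuousChangeAction._≤Δ_ Â)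
          (ContinuousChangeAction._≤Δ_ Â)
          (λ p → ∂Ev (f , proj₁ p) (δf , proj₂ p)))
    (f : ContFun Â) (δf : ChangeAction.Δ Û)
    (lfp-f : A) → IsLfp (ContinuousChangeAction._≤A_ Â) (proj₁ f) lfp-f →
    (lfp-f⊕δf : A) →
      IsLfp (ContinuousChangeAction._≤A_ Â) (proj₁ (ChangeAction._⊕_ Û f δf)) lfp-f⊕δf →
    (∂lfp : ContinuousChangeAction.Δ Â) →
      IsLfp (ContinuousChangeAction._≤Δ_ Â) (λ δa → ∂Ev (f , lfp-f) (δf , δa)) ∂lfp →
    lfp-f⊕δf ≡ ContinuousChangeAction._⊕_ Â lfp-f ∂lfp
mainTheorem20 Â Û ∂Ev ∂Ev-derivative ∂Ev-continuous f δf
  lfp-f lfp-f-isLfp lfp-g lfp-g-isLfp ∂lfp ∂lfp-isLfp =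
  ≤A.antisym (proj₂ lfp-g-isLfp _ (⊕-fixed (proj₁ lfp-f-isLfp) (proj₁ ∂lfp-isLfp)))
             (⊕-below-IsLfp lfp-f-isLfp ∂lfp-isLfp lfp-g-isLfp)
  where open LfpDerivative Â Û ∂Ev ∂Ev-derivative ∂Ev-continuous f δf
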